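{- Assume a graph $G$ with $n$ nodes and that the weight parameter is a rational number $\lambda=\frac{a}{b}$ (with integers $a\ge 0$, $b\ge 1$). If we set $\epsilon=\frac{2}{bn^3}$, then \textsc{STC-ILP} returns an exact (optimal) solution for the \textsc{stc-den} problem in $O(\log n+\log b)$ iterations.
   Context: Let $G=(V,E)$ be a finite simple undirected unweighted graph with $n=|V|$. For $U\subseteq V$, $E(U)$ is the set of edges with both endpoints in $U$. A labeling $L$ assigns each edge the label strong or weak. A labeling satisfies the strong triadic closure (STC) property in $(U,E(U))$ if for all distinct $x,y,z\in U$ with $(x,y),(y,z)\in E(U)$ both labeled strong, we have $(x,z)\in E$. Let $m_s(U,L)$, $m_w(U,L)$ be the numbers of strong and weak edges in $E(U)$; for nonempty $U$, $q(U,L;\lambda)=\frac{m_s(U,L)+\lambda m_w(U,L)}{|U|}$, with $\lambda\in[0,1]$. Problem \textsc{stc-den}: find nonempty $U$ and $L$ satisfying STC in $(U,E(U))$ maximizing $q(U,L;\lambda)$. Problem $\textsc{stc-den}(\alpha)$: find $U\subseteq V$ (possibly empty) and $L$ satisfying STC in $(U,E(U))$ maximizing $m_s(U,L)+\lambda m_w(U,L)-\alpha|U|$ (solved exactly). Algorithm \textsc{STC-ILP} with parameter $\epsilon>0$: maintain an interval $(L,U)$ initialized to $L=0$, $U=\frac{n-1}{2}$; repeatedly take the midpoint $\beta$, solve $\textsc{stc-den}(\beta)$ exactly, and set $L=\beta$ if the returned vertex set is nonempty and $U=\beta$ otherwise; stop once $|U-L|\le\epsilon L$ and return the solution of $\textsc{stc-den}(L)$.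 An iteration is one solve of $\textsc{stc-den}(\beta)$. -}

module Defs where

open import Data.Nat as ℕ using (ℕ; zero; suc; _∸_; _^_; NonZero)
open import Data.Nat.Properties using (m*n≢0)
open import Data.Fin using (Fin; toℕ)
open import Data.Bool using (Bool; true; false; if_then_else_; _∧_; not; T)
open import Data.List using (List; length; filterᵇ; allFin; cartesianProduct)
open import Data.Product using (_×_; _,_; proj₁; proj₂; ∃; ∃-syntax)
open import Data.Integer using (+_)
open import Data.Rational using (ℚ; 0ℚ; _+_; _-_; _*_; _≤_; _/_; ∣_∣; _≤ᵇ_)
open import Relation.Binary.PropositionalEquality using (_≡_; _≢_)
open import Data.Empty using (⊥)
open import Relation.Nullary using (¬_)

record Graph (n : ℕ) : Set where
  field
    adj    : Fin n → Fin n → Bool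
    sym    : ∀ x y → adj x y ≡ adj y x
    irrefl : ∀ x → adj x x ≡ false
open Graph public

VSet : ℕ → Set
VSet n = Fin n → Bool

-- An edge labeling: true = strong, false = weak.  Only the values on pairs
-- (x , y) with toℕ x < toℕ y are used (see `strong`), so every labeling of the
-- undirected edges is represented.
Labeling : ℕ → Set
Labeling n = Fin n → Fin n → Bool

strong : ∀ {n} → Labeling n → Fin n → Fin n → Bool
strong lab x y = if toℕ x ℕ.<ᵇ toℕ y then lab x y else lab y x

pairs : (n : ℕ) → List (Fin n × Fin n)
pairs n = filterᵇ (λ p → toℕ (proj₁ p) ℕ.<ᵇ toℕ (proj₂ p))
                  (cartesianProduct (allFin n) (allFin n))

inE : ∀ {n} → Graph n → VSet n → Fin n × Fin n → Bool
inE G U (x , y) = U x ∧ U y ∧ adj G x y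

card : ∀ {n} → VSet n → ℕ
card {n} U = length (filterᵇ U (allFin n))

mS : ∀ {n} → Graph n → VSet n → Labeling n → ℕ
mS {n} G U lab = length (filterᵇ (λ p → inE G U p ∧ strong lab (proj₁ p) (proj₂ p)) (pairs n))

mW : ∀ {n} → Graph n → VSet n → Labeling n → ℕ
mW {n} G U lab = length (filterᵇ (λ p → inE G U p ∧ not (strong lab (proj₁ p) (proj₂ p))) (pairs n))

STC : ∀ {n} → Graph n → VSet n → Labeling n → Set
STC {n} G U lab =
  ∀ (x y z : Fin n) → x ≢ z →
    T (U x) → T (U y) → T (U z) →
    T (adj G x y) → T (adj G y z) →
    T (strong lab x y) → T (strong lab y z) →
    T (adj G x z)

ℕtoℚ : ℕ → ℚ
ℕtoℚ k = + k / 1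

weight : ∀ {n} → Graph n → ℚ → VSet n → Labeling n → ℚ
weight G λ' U lab = ℕtoℚ (mS G U lab) + λ' * ℕtoℚ (mW G U lab)

-- p / k for a natural k (only used with k ≥ 1; value 0 for k = 0)
divℕ : ℚ → ℕ → ℚ
divℕ p zero    = 0ℚ
divℕ p (suc k) = p * (+ 1 / suc k)

density : ∀ {n} → Graph n → ℚ → VSet n → Labeling n → ℚ
density G λ' U lab = divℕ (weight G λ' U lab) (card U)

OptimalSTCDen : ∀ {n} → Graph n → ℚ → VSet n × Labeling n → Set
OptimalSTCDen {n} G λ' (U , lab) =
  (∃[ v ] T (U v)) × STC G U lab ×
  (∀ (U' : VSet n) (lab' : Labeling n) → ∃[ v ] T (U' v) → STC G U' lab' →
     density G λ' U' lab' ≤ density G λ' U lab)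

objAlpha : ∀ {n} → Graph n → ℚ → ℚ → VSet n → Labeling n → ℚ
objAlpha G λ' α U lab = weight G λ' U lab - α * ℕtoℚ (card U)

OptimalSTCDenα : ∀ {n} → Graph n → ℚ → ℚ → VSet n × Labeling n → Set
OptimalSTCDenα {n} G λ' α (U , lab) =
  STC G U lab ×
  (∀ (U' : VSet n) (lab' : Labeling n) → STC G U' lab' →
     objAlpha G λ' α U' lab' ≤ objAlpha G λ' α U lab)

Oracle : ℕ → Set
Oracle n = ℚ → VSet n × Labeling n

ExactOracle : ∀ {n} (G : Graph n) (λ' : ℚ) → Oracle n → Set
ExactOracle G λ' O = ∀ α → OptimalSTCDenα G λ' α (O α)

anyV : ∀ {n} → VSet n → Bool
anyV {n} U = not (length (filterᵇ U (allFin n)) ℕ.≡ᵇ 0)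

record State : Set where
  constructor ⟨_,_⟩
  field lo hi : ℚ
open State public

stopᵇ : ℚ → State → Bool
stopᵇ ε s = ∣ hi s - lo s ∣ ≤ᵇ ε * lo s

step : ∀ {n} → Oracle n → State → State
step O s =
  let β = (lo s + hi s) * (+ 1 / 2) in
  if anyV (proj₁ (O β)) then ⟨ β , hi s ⟩ else ⟨ lo s , β ⟩

-- state after k iterations (ignoring the stopping test)
run : ∀ {n} → Oracle n → ℚ → State → ℕ → State
run O ε s zero    = s
run O ε s (suc k) = run O ε (step O s) k

initState : ℕ → State
initState n = ⟨ 0ℚ , + (n ∸ 1) / 2 ⟩

StopsAfter : ∀ {n} → Oracle n → ℚ → ℕ → Set
StopsAfter {n} O ε k =
  T (stopᵇ ε (run O ε (initState n) k)) ×
  (∀ j → j ℕ.< k → ¬ T (stopᵇ ε (run O ε (initState n) j)))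

output : ∀ {n} → Oracle n → ℚ → ℕ → VSet n × Labeling n
output {n} O ε k = O (lo (run O ε (initState n) k))

-- ε = 2 / (b n³)
-- ε = 2 / (b n³)  (only used with b ≥ 1 and n ≥ 1; the value 0 in the
-- degenerate cases is irrelevant)
epsilon : (b n : ℕ) → ℚ
epsilon (suc b) (suc n) = + 2 / (suc b ℕ.* suc n ^ 3)
epsilon _       _       = 0ℚ

{-# OPTIONS --safe #-}

-- After k halvings the interval is [N i / 2^(k+1), N (i+1) / 2^(k+1)] with N = n - 1.  Exactness of
-- stc-den(α) supplies the invariant: comparing with the empty set, the answer at α has density at
-- least α, and if that answer is empty then every STC solution has density at most α.  So every
-- density lies below the upper end and, once i > 0, the answer at the lower end attains it.
-- Densities are fractions w / (b c) with c ≤ n, so two different ones are at least 1 / (b n²) apart.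
-- With ε = 2 / (b n³) the stopping test |U - L| ≤ ε L reads b n³ ≤ 2 i, and since 2 i ≤ 2^(k+1)
-- (densities are at most N / 2) the interval is then shorter than that gap: the answer at L is
-- optimal.  Conversely a single edge has density at least 1 / n, which forces 2^(k+1) ≤ n² (i + 1),
-- so the test succeeds once 2^(k+1) ≥ 2 b n⁵, that is within 5 ⌈log₂ n⌉ + ⌈log₂ b⌉ iterations.

module Submission where

open import Defs hiding (sym)
open import Data.Bool using (Bool; true; false; _∧_; _∨_; not; T; T?; if_then_else_)
open import Data.Bool.Properties using (T-≡; T-∧; T-∨)
open import Data.Empty using (⊥-elim)
open import Data.Fin as Fin using (Fin; toℕ)
import Data.Fin.Properties as Fin
open import Data.Integer as ℤ using (+_)
import Data.Integer.Properties as ℤ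
open import Data.List using ([]; _∷_; length; filterᵇ; tabulate; map; _++_; cartesianProduct; allFin)
open import Data.List.Properties
  using (length-++; filter-++; map-tabulate; length-tabulate; filter-none; filter-some; filter-notAll; length-filter)
open import Data.List.Relation.Unary.All using (universal)
open import Data.List.Relation.Unary.Any using (here)
open import Data.List.Membership.Propositional using (_∈_; lose)
open import Data.List.Membership.Propositional.Properties using (∈-allFin; ∈-filter⁺; ∈-filter⁻; ∈-cartesianProduct⁺)
open import Data.Nat
  using (ℕ; zero; suc; pred; _+_; _*_; _∸_; _^_; _≤_; _<_; z≤n; s≤s; NonZero; >-nonZero; >-nonZero⁻¹;
         _<ᵇ_; _≡ᵇ_; _≤?_; ⌊_/2⌋; ⌈_/2⌉)
open import Data.Nat.Properties
open import Data.Nat.Induction using (<-wellFounded)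
open import Data.Nat.Logarithm using (⌈log₂_⌉)
open import Data.Nat.Logarithm.Core using (⌈log2⌉)
open import Data.Nat.Tactic.RingSolver using (solve)
open import Data.Product using (_×_; _,_; proj₁; proj₂; ∃-syntax)
open import Data.Rational as ℚ using (ℚ; _/_; 0ℚ; ∣_∣; toℚᵘ)
import Data.Rational.Properties as ℚ
open import Data.Rational.Unnormalised as ℚᵘ using (mkℚᵘ; _≃_; *≡*; *≤*)
import Data.Rational.Unnormalised.Properties as ℚᵘ
open import Data.Sum using (_⊎_; inj₁; inj₂)
open import Function using (_∘_; _⇔_; mk⇔; Equivalence)
open import Induction.WellFounded using (Acc; acc)
open import Relation.Binary.Definitions using (tri<; tri≈; tri>)
open import Relation.Binary.PropositionalEquality
open import Relation.Nullary using (¬_; yes; no; contradiction)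
open import Relation.Nullary.Decidable using (isYes; toWitness; fromWitness)
open import Algebra.Properties.Semiring.Sum +-*-semiring
  using (sum; sum-syntax; sum-cong-≗; ∑-distrib-+; ∑-comm; *-distribˡ-sum; *-distribʳ-sum)
open import Algebra.Properties.Group ℚ.+-0-group using (//-rightDividesˡ; //-rightDividesʳ)

-- Fractions of natural numbers

private
  toℚᵘ-/ : ∀ x d .{{_ : NonZero d}} → toℚᵘ (+ x / d) ≃ mkℚᵘ (+ x) (pred d)
  toℚᵘ-/ x (suc d) = ℚ.toℚᵘ-fromℚᵘ (mkℚᵘ (+ x) d)

/≤/⇒*≤* : ∀ x d y e .{{_ : NonZero d}} .{{_ : NonZero e}} → + x / d ℚ.≤ + y / e → x * e ≤ y * d
/≤/⇒*≤* x d@(suc _) y e@(suc _) p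
  with *≤* q ← ℚᵘ.≤-respʳ-≃ (toℚᵘ-/ y e) (ℚᵘ.≤-respˡ-≃ (toℚᵘ-/ x d) (ℚ.toℚᵘ-mono-≤ p))
  rewrite sym (ℤ.pos-* x e) | sym (ℤ.pos-* y d) = ℤ.drop‿+≤+ q

*≤*⇒/≤/ : ∀ x d y e .{{_ : NonZero d}} .{{_ : NonZero e}} → x * e ≤ y * d → + x / d ℚ.≤ + y / e
*≤*⇒/≤/ x d@(suc _) y e@(suc _) p = ℚ.toℚᵘ-cancel-≤
  (ℚᵘ.≤-respʳ-≃ (ℚᵘ.≃-sym (toℚᵘ-/ y e)) (ℚᵘ.≤-respˡ-≃ (ℚᵘ.≃-sym (toℚᵘ-/ x d))
    (*≤* (subst₂ ℤ._≤_ (ℤ.pos-* x e) (ℤ.pos-* y d) (ℤ.+≤+ p)))))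

*≡*⇒/≡/ : ∀ x d y e .{{_ : NonZero d}} .{{_ : NonZero e}} → x * e ≡ y * d → + x / d ≡ + y / e
*≡*⇒/≡/ x d@(suc _) y e@(suc _) p = ℚ.toℚᵘ-injective (ℚᵘ.≃-trans (toℚᵘ-/ x d)
  (ℚᵘ.≃-trans (*≡* (trans (sym (ℤ.pos-* x e)) (trans (cong +_ p) (ℤ.pos-* y d))))
    (ℚᵘ.≃-sym (toℚᵘ-/ y e))))

private
  +-/ : ∀ {x y} d e .{{_ : NonZero d}} .{{_ : NonZero e}} →
        + x / d ℚ.+ + y / e ≡ _/_ (+ (x * e + y * d)) (d * e) {{m*n≢0 d e}}
  +-/ {x} {y} d@(suc _) e@(suc _) = ℚ.toℚᵘ-injective (ℚᵘ.≃-trans (ℚ.toℚᵘ-homo-+ (+ x / d) (+ y / e))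
    (ℚᵘ.≃-trans (ℚᵘ.+-cong (toℚᵘ-/ x d) (toℚᵘ-/ y e))
      (ℚᵘ.≃-trans (ℚᵘ.≃-reflexive (cong (λ z → mkℚᵘ z (pred (d * e))) numerator))
        (ℚᵘ.≃-sym (toℚᵘ-/ _ (d * e))))))
    where
    numerator : + x ℤ.* + e ℤ.+ + y ℤ.* + d ≡ + (x * e + y * d)
    numerator = trans (cong₂ ℤ._+_ (sym (ℤ.pos-* x e)) (sym (ℤ.pos-* y d))) (sym (ℤ.pos-+ (x * e) (y * d)))

  *-/ : ∀ {x y} d e .{{_ : NonZero d}} .{{_ : NonZero e}} →
        (+ x / d) ℚ.* (+ y / e) ≡ _/_ (+ (x * y)) (d * e) {{m*n≢0 d e}}
  *-/ {x} {y} d@(suc _) e@(suc _) = ℚ.toℚᵘ-injective (ℚᵘ.≃-trans (ℚ.toℚᵘ-homo-* (+ x / d) (+ y / e))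
    (ℚᵘ.≃-trans (ℚᵘ.*-cong (toℚᵘ-/ x d) (toℚᵘ-/ y e))
      (ℚᵘ.≃-trans (ℚᵘ.≃-reflexive (cong (λ z → mkℚᵘ z (pred (d * e))) (sym (ℤ.pos-* x y))))
        (ℚᵘ.≃-sym (toℚᵘ-/ _ (d * e))))))

/+/≡/ : ∀ x d y e z f .{{_ : NonZero d}} .{{_ : NonZero e}} .{{_ : NonZero f}} →
        (x * e + y * d) * f ≡ z * (d * e) → + x / d ℚ.+ + y / e ≡ + z / f
/+/≡/ x d y e z f eq = trans (+-/ {x} {y} d e) (*≡*⇒/≡/ (x * e + y * d) (d * e) z f {{m*n≢0 d e}} eq)

/*/≡/ : ∀ x d y e z f .{{_ : NonZero d}} .{{_ : NonZero e}} .{{_ : NonZero f}} →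
        x * y * f ≡ z * (d * e) → (+ x / d) ℚ.* (+ y / e) ≡ + z / f
/*/≡/ x d y e z f eq = trans (*-/ {x} {y} d e) (*≡*⇒/≡/ (x * y) (d * e) z f {{m*n≢0 d e}} eq)

0≤p-q⇒q≤p : ∀ {p q} → 0ℚ ℚ.≤ p ℚ.- q → q ℚ.≤ p
0≤p-q⇒q≤p {p} {q} h = subst₂ ℚ._≤_ (ℚ.+-identityˡ q) (//-rightDividesˡ q p) (ℚ.+-monoˡ-≤ q h)

p-q≤0⇒p≤q : ∀ {p q} → p ℚ.- q ℚ.≤ 0ℚ → p ℚ.≤ q
p-q≤0⇒p≤q {p} {q} h = subst₂ ℚ._≤_ (//-rightDividesˡ q p) (ℚ.+-identityˡ q) (ℚ.+-monoˡ-≤ q h)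

-- Arithmetic

-- w / (b c) ≥ x / d and w′ / (b c′) ≤ (x + δ) / d; were w′ / c′ > w / c, the two fractions would
-- differ by at least 1 / (b c c′) > δ / d.
short-interval⇒≤ : ∀ {x δ b c c′ w w′ d} →
  w′ * d ≤ (x + δ) * c′ * b → x * c * b ≤ w * d → δ * c * c′ * b < d → w′ * c ≤ w * c′
short-interval⇒≤ {x} {δ} {b} {c} {c′} {w} {w′} {d} upper lower short with w′ * c ≤? w * c′
... | yes w′c≤wc′ = w′c≤wc′
... | no w′c≰wc′ = contradiction d≤δcc′b (<⇒≱ short)
  where
  open ≤-Reasoning
  d≤δcc′b : d ≤ δ * c * c′ * b
  d≤δcc′b = +-cancelʳ-≤ (x * c * b * c′) d (δ * c * c′ * b) (begin
    d + x * c * b * c′        ≤⟨ +-monoʳ-≤ d (*-monoˡ-≤ c′ lower) ⟩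
    d + w * d * c′            ≡⟨ solve (d ∷ w ∷ c′ ∷ []) ⟩
    d * suc (w * c′)          ≤⟨ *-monoʳ-≤ d (≰⇒> w′c≰wc′) ⟩
    d * (w′ * c)              ≡⟨ solve (d ∷ w′ ∷ c ∷ []) ⟩
    w′ * d * c                ≤⟨ *-monoˡ-≤ c upper ⟩
    (x + δ) * c′ * b * c      ≡⟨ solve (x ∷ δ ∷ b ∷ c ∷ c′ ∷ []) ⟩
    δ * c * c′ * b + x * c * b * c′ ∎)

cross-≤-trans : ∀ {x y w s d e} .{{_ : NonZero s}} → x * s ≤ w * d → w * e ≤ y * s → x * e ≤ y * d
cross-≤-trans {x} {y} {w} {s} {d} {e} xs≤wd we≤ys = *-cancelˡ-≤ s (begin
  s * (x * e)  ≡⟨ solve (x ∷ s ∷ e ∷ []) ⟩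
  x * s * e    ≤⟨ *-monoˡ-≤ e xs≤wd ⟩
  w * d * e    ≡⟨ solve (w ∷ d ∷ e ∷ []) ⟩
  w * e * d    ≤⟨ *-monoˡ-≤ d we≤ys ⟩
  y * s * d    ≡⟨ solve (y ∷ s ∷ d ∷ []) ⟩
  s * (y * d)  ∎)
  where open ≤-Reasoning

2m≤1+i⇒m≤2i : ∀ {m i} → 1 ≤ m → 2 * m ≤ suc i → m ≤ 2 * i
2m≤1+i⇒m≤2i {suc m} {i} _ 2m≤1+i = ≤-trans m<i (m≤n*m i 2)
  where
  m<i : suc m ≤ i
  m<i = ≤-trans (m≤n+m (suc m) m) (≤-pred (subst (_≤ suc i) (cong (λ z → suc (m + suc z)) (+-identityʳ m)) 2m≤1+i))

n≤2^⌈log₂n⌉ : ∀ n → n ≤ 2 ^ ⌈log₂ n ⌉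
n≤2^⌈log₂n⌉ n = n≤2^⌈log2⌉ n (<-wellFounded n)
  where
  n≤2^⌈log2⌉ : ∀ n (rec : Acc _<_ n) → n ≤ 2 ^ ⌈log2⌉ n rec
  n≤2^⌈log2⌉ zero          _         = z≤n
  n≤2^⌈log2⌉ (suc zero)    _         = s≤s z≤n
  n≤2^⌈log2⌉ (suc (suc n)) (acc rec) = begin
    suc (suc n)                       ≡⟨ cong (suc ∘ suc) (⌊n/2⌋+⌈n/2⌉≡n n) ⟨
    suc (suc (⌊ n /2⌋ + ⌈ n /2⌉))     ≤⟨ s≤s (s≤s (+-monoˡ-≤ ⌈ n /2⌉ (⌊n/2⌋≤⌈n/2⌉ n))) ⟩
    suc (suc (⌈ n /2⌉ + ⌈ n /2⌉))     ≡⟨ cong suc (+-suc ⌈ n /2⌉ ⌈ n /2⌉) ⟨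
    suc ⌈ n /2⌉ + suc ⌈ n /2⌉         ≤⟨ +-mono-≤ ih (≤-trans ih (m≤m+n _ 0)) ⟩
    2 * 2 ^ ⌈log2⌉ (suc ⌈ n /2⌉) _    ∎
    where
    open ≤-Reasoning
    ih = n≤2^⌈log2⌉ (suc ⌈ n /2⌉) (rec (⌈n/2⌉<n n))

least-witness : ∀ (f : ℕ → Bool) K → T (f K) → ∃[ k ] (k ≤ K × T (f k) × (∀ j → j < k → ¬ T (f j)))
least-witness f zero    fK = 0 , z≤n , fK , λ _ ()
least-witness f (suc K) fK with f 0 in f0
... | true  = 0 , z≤n , subst T (sym f0) _ , λ _ ()
... | false with least-witness (f ∘ suc) K fK
...   | k , k≤K , fk , below = suc k , s≤s k≤K , fk , λ where
          zero    _         → subst T f0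
          (suc j) (s≤s j<k) → below j j<k

m*5+n≤5*[m+n] : ∀ m n → m * 5 + n ≤ 5 * (m + n)
m*5+n≤5*[m+n] m n = ≤-trans (m≤m+n (m * 5 + n) (4 * n)) (≤-reflexive regroup)
  where
  regroup : m * 5 + n + 4 * n ≡ 5 * (m + n)
  regroup = solve (m ∷ n ∷ [])

2bn⁵≤2^[1+5⌈log₂n⌉+⌈log₂b⌉] : ∀ n b → 2 * (b * n ^ 3) * (n * n) ≤ 2 ^ suc (⌈log₂ n ⌉ * 5 + ⌈log₂ b ⌉)
2bn⁵≤2^[1+5⌈log₂n⌉+⌈log₂b⌉] n b = begin
  2 * (b * n ^ 3) * (n * n)                  ≡⟨ regroup ⟩
  2 * (n ^ 5 * b)
    ≤⟨ *-monoʳ-≤ 2 (*-mono-≤ (^-monoˡ-≤ 5 (n≤2^⌈log₂n⌉ n)) (n≤2^⌈log₂n⌉ b)) ⟩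
  2 * ((2 ^ ⌈log₂ n ⌉) ^ 5 * 2 ^ ⌈log₂ b ⌉)
    ≡⟨ cong (λ p → 2 * (p * 2 ^ ⌈log₂ b ⌉)) (^-*-assoc 2 ⌈log₂ n ⌉ 5) ⟩
  2 * (2 ^ (⌈log₂ n ⌉ * 5) * 2 ^ ⌈log₂ b ⌉)
    ≡⟨ cong (2 *_) (^-distribˡ-+-* 2 (⌈log₂ n ⌉ * 5) ⌈log₂ b ⌉) ⟨
  2 ^ suc (⌈log₂ n ⌉ * 5 + ⌈log₂ b ⌉)        ∎
  where
  open ≤-Reasoning
  regroup : 2 * (b * (n * (n * (n * 1)))) * (n * n) ≡ 2 * (n * (n * (n * (n * (n * 1)))) * b)
  regroup = solve (n ∷ b ∷ [])

-- Counting

indicator : Bool → ℕ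
indicator true  = 1
indicator false = 0

∑-mono-≤ : ∀ {n} {f g : Fin n → ℕ} → (∀ i → f i ≤ g i) → sum f ≤ sum g
∑-mono-≤ {zero}  f≤g = z≤n
∑-mono-≤ {suc n} f≤g = +-mono-≤ (f≤g Fin.zero) (∑-mono-≤ (f≤g ∘ Fin.suc))

private
  variable
    A : Set

length-filterᵇ-tabulate : ∀ {n} (p : A → Bool) (g : Fin n → A) →
                          length (filterᵇ p (tabulate g)) ≡ ∑[ i < n ] indicator (p (g i))
length-filterᵇ-tabulate {n = zero}  p g = refl
length-filterᵇ-tabulate {n = suc n} p g with p (g Fin.zero)
... | true  = cong suc (length-filterᵇ-tabulate p (g ∘ Fin.suc))
... | false = length-filterᵇ-tabulate p (g ∘ Fin.suc)

length-filterᵇ-none : ∀ (p : A → Bool) xs → (∀ x → ¬ T (p x)) → length (filterᵇ p xs) ≡ 0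
length-filterᵇ-none p xs none = cong length (filter-none (T? ∘ p) (universal none xs))

filterᵇ-filterᵇ : ∀ (p q : A → Bool) xs → filterᵇ q (filterᵇ p xs) ≡ filterᵇ (λ x → p x ∧ q x) xs
filterᵇ-filterᵇ p q [] = refl
filterᵇ-filterᵇ p q (x ∷ xs) with p x
... | false = filterᵇ-filterᵇ p q xs
... | true with q x
...   | true  = cong (x ∷_) (filterᵇ-filterᵇ p q xs)
...   | false = filterᵇ-filterᵇ p q xs

length-filterᵇ-∧-split : ∀ (p q : A → Bool) xs →
  length (filterᵇ (λ x → p x ∧ q x) xs) + length (filterᵇ (λ x → p x ∧ not (q x)) xs) ≡ length (filterᵇ p xs)
length-filterᵇ-∧-split p q [] = refl
length-filterᵇ-∧-split p q (x ∷ xs) with p x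
... | false = length-filterᵇ-∧-split p q xs
... | true with q x
...   | true  = cong suc (length-filterᵇ-∧-split p q xs)
...   | false = trans (+-suc _ _) (cong suc (length-filterᵇ-∧-split p q xs))

length-filterᵇ-mono : ∀ {p q : A → Bool} xs → (∀ x → T (p x) → T (q x)) →
                      length (filterᵇ p xs) ≤ length (filterᵇ q xs)
length-filterᵇ-mono [] p⇒q = z≤n
length-filterᵇ-mono {p = p} {q = q} (x ∷ xs) p⇒q with p x | q x | p⇒q x
... | true  | true  | _  = s≤s (length-filterᵇ-mono xs p⇒q)
... | true  | false | pq with () ← pq _
... | false | true  | _  = m≤n⇒m≤1+n (length-filterᵇ-mono xs p⇒q)
... | false | false | _  = length-filterᵇ-mono xs p⇒q

length-filterᵇ-cartesianProduct : ∀ {m n} (p : A × A → Bool) (g : Fin m → A) (h : Fin n → A) →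
  length (filterᵇ p (cartesianProduct (tabulate g) (tabulate h)))
    ≡ ∑[ i < m ] ∑[ j < n ] indicator (p (g i , h j))
length-filterᵇ-cartesianProduct {m = zero}  p g h = refl
length-filterᵇ-cartesianProduct {m = suc m} {n} p g h = begin
  length (filterᵇ p (map (g Fin.zero ,_) (tabulate h) ++ rest))
    ≡⟨ cong length (filter-++ (T? ∘ p) (map (g Fin.zero ,_) (tabulate h)) rest) ⟩
  length (filterᵇ p (map (g Fin.zero ,_) (tabulate h)) ++ filterᵇ p rest)
    ≡⟨ length-++ (filterᵇ p (map (g Fin.zero ,_) (tabulate h))) ⟩
  length (filterᵇ p (map (g Fin.zero ,_) (tabulate h))) + length (filterᵇ p rest)
    ≡⟨ cong₂ _+_ (cong (length ∘ filterᵇ p) (map-tabulate h (g Fin.zero ,_)))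
                 (length-filterᵇ-cartesianProduct p (g ∘ Fin.suc) h) ⟩
  length (filterᵇ p (tabulate ((g Fin.zero ,_) ∘ h))) + ∑[ i < m ] ∑[ j < n ] indicator (p (g (Fin.suc i) , h j))
    ≡⟨ cong (_+ _) (length-filterᵇ-tabulate p ((g Fin.zero ,_) ∘ h)) ⟩
  ∑[ j < n ] indicator (p (g Fin.zero , h j)) + ∑[ i < m ] ∑[ j < n ] indicator (p (g (Fin.suc i) , h j)) ∎
  where
  open ≡-Reasoning
  rest = cartesianProduct (tabulate (g ∘ Fin.suc)) (tabulate h)

-- Vertex sets and edges

Nonempty : ∀ {n} → VSet n → Set
Nonempty U = ∃[ v ] T (U v)

indicator-<ᵇ-both-ways : ∀ m k u v →
  indicator ((m <ᵇ k) ∧ (u ∧ v)) + indicator ((k <ᵇ m) ∧ (v ∧ u)) ≤ indicator u * indicator (not (m ≡ᵇ k))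
indicator-<ᵇ-both-ways zero    zero    u     v     = z≤n
indicator-<ᵇ-both-ways zero    (suc k) false false = z≤n
indicator-<ᵇ-both-ways zero    (suc k) false true  = z≤n
indicator-<ᵇ-both-ways zero    (suc k) true  false = z≤n
indicator-<ᵇ-both-ways zero    (suc k) true  true  = s≤s z≤n
indicator-<ᵇ-both-ways (suc m) zero    false false = z≤n
indicator-<ᵇ-both-ways (suc m) zero    false true  = z≤n
indicator-<ᵇ-both-ways (suc m) zero    true  false = z≤n
indicator-<ᵇ-both-ways (suc m) zero    true  true  = s≤s z≤n
indicator-<ᵇ-both-ways (suc m) (suc k) u     v     = indicator-<ᵇ-both-ways m k u v

0<c⇒not[c≡ᵇ0] : ∀ {c} → 0 < c → not (c ≡ᵇ 0) ≡ true
0<c⇒not[c≡ᵇ0] (s≤s _) = refl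

module _ {n : ℕ} where

  card≡∑ : (U : VSet n) → card U ≡ ∑[ v < n ] indicator (U v)
  card≡∑ U = length-filterᵇ-tabulate U (λ v → v)

  card≤n : (U : VSet n) → card U ≤ n
  card≤n U = subst (card U ≤_) (length-tabulate {n = n} (λ v → v)) (length-filter (T? ∘ U) (allFin n))

  nonempty⇒0<card : (U : VSet n) → Nonempty U → 1 ≤ card U
  nonempty⇒0<card U (v , Uv) = filter-some (T? ∘ U) (lose (∈-allFin v) Uv)

  anyV⇒nonempty : (U : VSet n) → T (anyV U) → Nonempty U
  anyV⇒nonempty U t with filterᵇ U (allFin n) in eq
  ... | v ∷ _ = v , proj₂ (∈-filter⁻ (T? ∘ U) {xs = allFin n} (subst (v ∈_) (sym eq) (here refl)))

  anyV≡false⇒empty : (U : VSet n) → anyV U ≡ false → ∀ v → ¬ T (U v)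
  anyV≡false⇒empty U anyV≡false v Uv with () ← trans (sym (0<c⇒not[c≡ᵇ0] (nonempty⇒0<card U (v , Uv)))) anyV≡false

  ∑-distinct≤n∸1 : (x : Fin n) → ∑[ y < n ] indicator (not (toℕ x ≡ᵇ toℕ y)) ≤ n ∸ 1
  ∑-distinct≤n∸1 x = <⇒≤pred (begin-strict
    ∑[ y < n ] indicator (not (toℕ x ≡ᵇ toℕ y))
      ≡⟨ length-filterᵇ-tabulate {n = n} (λ y → not (toℕ x ≡ᵇ toℕ y)) (λ y → y) ⟨
    length (filterᵇ (λ y → not (toℕ x ≡ᵇ toℕ y)) (allFin n))
      <⟨ filter-notAll (T? ∘ λ y → not (toℕ x ≡ᵇ toℕ y)) (allFin n) (lose (∈-allFin x) x≢x-false) ⟩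
    length (allFin n)                                 ≡⟨ length-tabulate {n = n} (λ y → y) ⟩
    n                                                 ∎)
    where
    open ≤-Reasoning
    x≢x-false : ¬ T (not (toℕ x ≡ᵇ toℕ x))
    x≢x-false = subst (T ∘ not) (Equivalence.to T-≡ (≡⇒≡ᵇ (toℕ x) (toℕ x) refl))

  pairsIn : VSet n → ℕ
  pairsIn U = length (filterᵇ (λ p → U (proj₁ p) ∧ U (proj₂ p)) (pairs n))

  edges≤pairsIn : ∀ (G : Graph n) U L → mS G U L + mW G U L ≤ pairsIn U
  edges≤pairsIn G U L = begin
    mS G U L + mW G U L
      ≡⟨ length-filterᵇ-∧-split (inE G U) (λ p → strong L (proj₁ p) (proj₂ p)) (pairs n) ⟩
    length (filterᵇ (inE G U) (pairs n))
      ≤⟨ length-filterᵇ-mono (pairs n) inE⇒both ⟩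
    pairsIn U ∎
    where
    open ≤-Reasoning
    inE⇒both : ∀ p → T (inE G U p) → T (U (proj₁ p) ∧ U (proj₂ p))
    inE⇒both (x , y) with U x | U y
    ... | true  | true  = _
    ... | true  | false = λ ()
    ... | false | _     = λ ()

  pairsIn+pairsIn≤card*[n∸1] : ∀ U → pairsIn U + pairsIn U ≤ card U * (n ∸ 1)
  pairsIn+pairsIn≤card*[n∸1] U = begin
    pairsIn U + pairsIn U
      ≡⟨ cong₂ _+_ pairsIn≡∑∑ (trans pairsIn≡∑∑ (∑-comm h)) ⟩
    ∑[ x < n ] ∑[ y < n ] h x y + ∑[ x < n ] ∑[ y < n ] h y x
      ≡⟨ ∑-distrib-+ (λ x → ∑[ y < n ] h x y) (λ x → ∑[ y < n ] h y x) ⟨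
    ∑[ x < n ] (∑[ y < n ] h x y + ∑[ y < n ] h y x)
      ≡⟨ sum-cong-≗ (λ x → ∑-distrib-+ (h x) (λ y → h y x)) ⟨
    ∑[ x < n ] ∑[ y < n ] (h x y + h y x)
      ≤⟨ ∑-mono-≤ (λ x → ∑-mono-≤ (λ y → indicator-<ᵇ-both-ways (toℕ x) (toℕ y) (U x) (U y))) ⟩
    ∑[ x < n ] ∑[ y < n ] (indicator (U x) * indicator (not (toℕ x ≡ᵇ toℕ y)))
      ≡⟨ sum-cong-≗ (λ x → *-distribˡ-sum {n = n} (indicator (U x)) (λ y → indicator (not (toℕ x ≡ᵇ toℕ y)))) ⟨
    ∑[ x < n ] (indicator (U x) * ∑[ y < n ] indicator (not (toℕ x ≡ᵇ toℕ y)))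
      ≤⟨ ∑-mono-≤ (λ x → *-monoʳ-≤ (indicator (U x)) (∑-distinct≤n∸1 x)) ⟩
    ∑[ x < n ] (indicator (U x) * (n ∸ 1))
      ≡⟨ *-distribʳ-sum (n ∸ 1) (indicator ∘ U) ⟨
    ∑[ x < n ] indicator (U x) * (n ∸ 1)
      ≡⟨ cong (_* (n ∸ 1)) (card≡∑ U) ⟨
    card U * (n ∸ 1) ∎
    where
    open ≤-Reasoning
    h : Fin n → Fin n → ℕ
    h x y = indicator ((toℕ x <ᵇ toℕ y) ∧ (U x ∧ U y))
    pairsIn≡∑∑ : pairsIn U ≡ ∑[ x < n ] ∑[ y < n ] h x y
    pairsIn≡∑∑ = trans (cong length (filterᵇ-filterᵇ ordered both (cartesianProduct (allFin n) (allFin n))))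
                       (length-filterᵇ-cartesianProduct (λ p → ordered p ∧ both p) (λ x → x) (λ y → y))
      where
      ordered both : Fin n × Fin n → Bool
      ordered p = toℕ (proj₁ p) <ᵇ toℕ (proj₂ p)
      both p = U (proj₁ p) ∧ U (proj₂ p)

  module _ (G : Graph n) {U : VSet n} (empty : ∀ v → ¬ T (U v)) where

    card-empty : card U ≡ 0
    card-empty = length-filterᵇ-none U (allFin n) empty

    private
      no-edge : ∀ s p → ¬ T (inE G U p ∧ s)
      no-edge s (x , y) t = empty x (proj₁ (Equivalence.to T-∧ (proj₁ (Equivalence.to T-∧ t))))

    mS-empty : ∀ L → mS G U L ≡ 0
    mS-empty L = length-filterᵇ-none _ (pairs n) (λ p → no-edge (strong L (proj₁ p) (proj₂ p)) p)

    mW-empty : ∀ L → mW G U L ≡ 0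
    mW-empty L = length-filterᵇ-none _ (pairs n) (λ p → no-edge (not (strong L (proj₁ p) (proj₂ p))) p)

  ordered-edge : ∀ (G : Graph n) → ∃[ x ] ∃[ y ] T (adj G x y) → ∃[ x ] ∃[ y ] (toℕ x < toℕ y × T (adj G x y))
  ordered-edge G (x , y , xy) with <-cmp (toℕ x) (toℕ y)
  ... | tri< x<y _ _ = x , y , x<y , xy
  ... | tri≈ _ x≡y _ rewrite Fin.toℕ-injective x≡y = ⊥-elim (subst T (irrefl G y) xy)
  ... | tri> _ _ y<x = y , x , y<x , subst T (Graph.sym G x y) xy

  allStrong : Labeling n
  allStrong _ _ = true

  edgeSet : Fin n → Fin n → VSet n
  edgeSet x y v = isYes (v Fin.≟ x) ∨ isYes (v Fin.≟ y)

  module _ (G : Graph n) {x y : Fin n} where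

    private
      edgeSet-member : ∀ {v} → T (edgeSet x y v) → v ≡ x ⊎ v ≡ y
      edgeSet-member {v} t with Equivalence.to (T-∨ {isYes (v Fin.≟ x)}) t
      ... | inj₁ v≡x = inj₁ (toWitness v≡x)
      ... | inj₂ v≡y = inj₂ (toWitness v≡y)

      x∈edgeSet : T (edgeSet x y x)
      x∈edgeSet = Equivalence.from (T-∨ {isYes (x Fin.≟ x)}) (inj₁ (fromWitness refl))

      y∈edgeSet : T (edgeSet x y y)
      y∈edgeSet = Equivalence.from (T-∨ {isYes (y Fin.≟ x)}) (inj₂ (fromWitness refl))

      loop-free : ∀ {v} → ¬ T (adj G v v)
      loop-free {v} = subst T (irrefl G v)

    edgeSet-STC : ∀ L → STC G (edgeSet x y) L
    edgeSet-STC L p q r p≢r Up Uq Ur pq qr _ _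
      with edgeSet-member {p} Up | edgeSet-member {q} Uq | edgeSet-member {r} Ur
    ... | inj₁ refl | inj₁ refl | _         = ⊥-elim (loop-free pq)
    ... | inj₂ refl | inj₂ refl | _         = ⊥-elim (loop-free pq)
    ... | _         | inj₁ refl | inj₁ refl = ⊥-elim (loop-free qr)
    ... | _         | inj₂ refl | inj₂ refl = ⊥-elim (loop-free qr)
    ... | inj₁ refl | inj₂ refl | inj₁ refl = ⊥-elim (p≢r refl)
    ... | inj₂ refl | inj₁ refl | inj₂ refl = ⊥-elim (p≢r refl)

    edgeSet-strong : toℕ x < toℕ y → T (adj G x y) → 1 ≤ mS G (edgeSet x y) allStrong
    edgeSet-strong x<y xy = filter-some (T? ∘ _) (lose xy∈pairs strong-edge)
      where
      xy∈pairs : (x , y) ∈ pairs n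
      xy∈pairs = ∈-filter⁺ (T? ∘ _) (∈-cartesianProduct⁺ (∈-allFin x) (∈-allFin y)) (<⇒<ᵇ x<y)
      strong-edge : T (inE G (edgeSet x y) (x , y) ∧ strong allStrong x y)
      strong-edge rewrite Equivalence.to T-≡ (<⇒<ᵇ x<y) =
        Equivalence.from (T-∧ {inE G (edgeSet x y) (x , y)}) (Equivalence.from (T-∧ {edgeSet x y x})
          (x∈edgeSet , Equivalence.from (T-∧ {edgeSet x y y}) (y∈edgeSet , xy)) , _)

-- Densities for λ = a / b

objAlpha-empty≡0 : ∀ {n} (G : Graph n) λ′ α {U : VSet n} L → (∀ v → ¬ T (U v)) → objAlpha G λ′ α U L ≡ 0ℚ
objAlpha-empty≡0 G λ′ α L empty
  rewrite mS-empty G empty L | mW-empty G empty L | card-empty G empty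
        | ℚ.*-zeroʳ λ′ | ℚ.*-zeroʳ α = refl

module Objective {n : ℕ} (G : Graph n) (a b : ℕ) .{{_ : NonZero b}} where

  -- b (m_s + λ m_w), so that the density of (U , L) is scaledWeight U L / (b |U|).
  scaledWeight : VSet n → Labeling n → ℕ
  scaledWeight U L = b * mS G U L + a * mW G U L

  DensityAtMost DensityAtLeast : VSet n × Labeling n → ℕ → ℕ → Set
  DensityAtMost  (U , L) x d = scaledWeight U L * d ≤ x * card U * b
  DensityAtLeast (U , L) x d = x * card U * b ≤ scaledWeight U L * d

  weight≡ : ∀ U L → weight G (+ a / b) U L ≡ + scaledWeight U L / b
  weight≡ U L = begin
    + s / 1 ℚ.+ (+ a / b) ℚ.* (+ w / 1)
      ≡⟨ cong (+ s / 1 ℚ.+_) (/*/≡/ a b w 1 (a * w) b (cong (a * w *_) (sym (*-identityʳ b)))) ⟩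
    + s / 1 ℚ.+ + (a * w) / b            ≡⟨ /+/≡/ s 1 (a * w) b (scaledWeight U L) b (common-denominator s w) ⟩
    + scaledWeight U L / b               ∎
    where
    open ≡-Reasoning
    s = mS G U L
    w = mW G U L
    common-denominator : ∀ s w → (s * b + a * w * 1) * b ≡ (b * s + a * w) * (1 * b)
    common-denominator s w = solve (s ∷ w ∷ a ∷ b ∷ [])

  objAlpha≡ : ∀ x d .{{_ : NonZero d}} U L →
              objAlpha G (+ a / b) (+ x / d) U L ≡ + scaledWeight U L / b ℚ.- + (x * card U) / d
  objAlpha≡ x d U L = cong₂ ℚ._-_ (weight≡ U L)
    (/*/≡/ x d (card U) 1 (x * card U) d (cong (x * card U *_) (sym (*-identityʳ d))))

  *≤*⇒density≤ : ∀ {U L U′ L′} → 0 < card U → 0 < card U′ →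
                 scaledWeight U L * card U′ ≤ scaledWeight U′ L′ * card U →
                 density G (+ a / b) U L ℚ.≤ density G (+ a / b) U′ L′
  *≤*⇒density≤ {U} {L} {U′} {L′} 0<c 0<c′ cross =
    subst₂ ℚ._≤_ (cong (λ q → divℕ q (card U)) (sym (weight≡ U L)))
                 (cong (λ q → divℕ q (card U′)) (sym (weight≡ U′ L′)))
      (*≤*⇒divℕ≤ {scaledWeight U L} {card U} {scaledWeight U′ L′} {card U′} 0<c 0<c′ cross)
    where
    *≤*⇒divℕ≤ : ∀ {w c w′ c′} → 0 < c → 0 < c′ → w * c′ ≤ w′ * c → divℕ (+ w / b) c ℚ.≤ divℕ (+ w′ / b) c′
    *≤*⇒divℕ≤ {w} {suc c} {w′} {suc c′} _ _ cross =
      subst₂ ℚ._≤_ (sym (/*/≡/ w b 1 (suc c) w (b * suc c) (*-identityʳ-* w)))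
                   (sym (/*/≡/ w′ b 1 (suc c′) w′ (b * suc c′) (*-identityʳ-* w′)))
        (*≤*⇒/≤/ w (b * suc c) w′ (b * suc c′) (begin
          w * (b * suc c′)   ≡⟨ solve (w ∷ b ∷ c′ ∷ []) ⟩
          b * (w * suc c′)   ≤⟨ *-monoʳ-≤ b cross ⟩
          b * (w′ * suc c)   ≡⟨ solve (w′ ∷ b ∷ c ∷ []) ⟩
          w′ * (b * suc c)   ∎))
      where
      open ≤-Reasoning
      instance
        _ = m*n≢0 b (suc c)
        _ = m*n≢0 b (suc c′)
      *-identityʳ-* : ∀ {d} v → v * 1 * d ≡ v * d
      *-identityʳ-* v = cong (_* _) (*-identityʳ v)

  density≤[n∸1]/2 : a ≤ b → ∀ U L → DensityAtMost (U , L) (n ∸ 1) 2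
  density≤[n∸1]/2 a≤b U L = weight-bound (mS G U L) (mW G U L) (card U) (n ∸ 1) {pairsIn U}
    (+-mono-≤ (edges≤pairsIn G U L) (edges≤pairsIn G U L)) (pairsIn+pairsIn≤card*[n∸1] U)
    where
    weight-bound : ∀ s w c N {p} → (s + w) + (s + w) ≤ p + p → p + p ≤ c * N → (b * s + a * w) * 2 ≤ N * c * b
    weight-bound s w c N {p} edges pairs = begin
      (b * s + a * w) * 2      ≤⟨ *-monoˡ-≤ 2 (+-monoʳ-≤ (b * s) (*-monoˡ-≤ w a≤b)) ⟩
      (b * s + b * w) * 2      ≡⟨ solve (b ∷ s ∷ w ∷ []) ⟩
      b * ((s + w) + (s + w))  ≤⟨ *-monoʳ-≤ b (≤-trans edges pairs) ⟩
      b * (c * N)              ≡⟨ solve (b ∷ c ∷ N ∷ []) ⟩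
      N * c * b                ∎
      where open ≤-Reasoning

  DensityAtMost-double : ∀ {s x d} → DensityAtMost s x d → DensityAtMost s (2 * x) (2 * d)
  DensityAtMost-double {U , L} {x} {d} = doubled (scaledWeight U L) (card U)
    where
    doubled : ∀ w c → w * d ≤ x * c * b → w * (2 * d) ≤ 2 * x * c * b
    doubled w c h = begin
      w * (2 * d)    ≡⟨ solve (w ∷ d ∷ []) ⟩
      2 * (w * d)    ≤⟨ *-monoʳ-≤ 2 h ⟩
      2 * (x * c * b) ≡⟨ solve (x ∷ c ∷ b ∷ []) ⟩
      2 * x * c * b  ∎
      where open ≤-Reasoning

  DensityAtLeast-double : ∀ {s x d} → DensityAtLeast s x d → DensityAtLeast s (2 * x) (2 * d)
  DensityAtLeast-double {U , L} {x} {d} = doubled (scaledWeight U L) (card U)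
    where
    doubled : ∀ w c → x * c * b ≤ w * d → 2 * x * c * b ≤ w * (2 * d)
    doubled w c h = begin
      2 * x * c * b   ≡⟨ solve (x ∷ c ∷ b ∷ []) ⟩
      2 * (x * c * b) ≤⟨ *-monoʳ-≤ 2 h ⟩
      2 * (w * d)     ≡⟨ solve (w ∷ d ∷ []) ⟩
      w * (2 * d)     ∎
      where open ≤-Reasoning

  density-bounds-ordered : ∀ {U L x d y e} → 0 < card U →
                           DensityAtLeast (U , L) x d → DensityAtMost (U , L) y e → x * e ≤ y * d
  density-bounds-ordered {U} {L} {x} {d} {y} {e} 0<c lower upper =
    cross-≤-trans {x} {y} {scaledWeight U L} {card U * b} {d} {e} {{m*n≢0 (card U) b {{>-nonZero 0<c}}}}
      (≤-trans (≤-reflexive (sym (*-assoc x (card U) b))) lower)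
      (≤-trans upper (≤-reflexive (*-assoc y (card U) b)))

  module _ (O : Oracle n) (exact : ExactOracle G (+ a / b) O) where

    private
      ∅ : VSet n
      ∅ _ = false

      ∅-STC : ∀ L → STC G ∅ L
      ∅-STC L _ _ _ _ ()

    oracle-DensityAtLeast : ∀ x d .{{_ : NonZero d}} → DensityAtLeast (O (+ x / d)) x d
    oracle-DensityAtLeast x d = /≤/⇒*≤* (x * card U) d (scaledWeight U L) b (0≤p-q⇒q≤p 0≤objective)
      where
      U = proj₁ (O (+ x / d))
      L = proj₂ (O (+ x / d))
      0≤objective : 0ℚ ℚ.≤ + scaledWeight U L / b ℚ.- + (x * card U) / d
      0≤objective = subst₂ ℚ._≤_ (objAlpha-empty≡0 G (+ a / b) (+ x / d) L (λ _ ())) (objAlpha≡ x d U L)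
                      (proj₂ (exact (+ x / d)) ∅ L (∅-STC L))

    oracle-empty⇒DensityAtMost : ∀ x d .{{_ : NonZero d}} → anyV (proj₁ (O (+ x / d))) ≡ false →
                                 ∀ U L → STC G U L → DensityAtMost (U , L) x d
    oracle-empty⇒DensityAtMost x d empty U L stc =
      /≤/⇒*≤* (scaledWeight U L) b (x * card U) d (p-q≤0⇒p≤q objective≤0)
      where
      Uₒ = proj₁ (O (+ x / d))
      Lₒ = proj₂ (O (+ x / d))
      objective≤0 : + scaledWeight U L / b ℚ.- + (x * card U) / d ℚ.≤ 0ℚ
      objective≤0 = subst₂ ℚ._≤_ (objAlpha≡ x d U L)
                      (objAlpha-empty≡0 G (+ a / b) (+ x / d) Lₒ (anyV≡false⇒empty Uₒ empty))
                      (proj₂ (exact (+ x / d)) U L stc)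

-- The bisection

stopᵇ-bracket⇔ : ∀ {N} .{{_ : NonZero N}} b .{{_ : NonZero b}} d .{{_ : NonZero d}} i →
  T (stopᵇ (epsilon b (suc N)) ⟨ + (N * i) / d , + (N * suc i) / d ⟩) ⇔ b * suc N ^ 3 ≤ 2 * i
stopᵇ-bracket⇔ {N} b@(suc _) d i =
  mk⇔ (λ stop → from-cross (/≤/⇒*≤* N d (2 * (N * i)) (B * d) (ℚ.≤ᵇ⇒≤ (subst T test≡ stop))))
      (λ B≤2i → subst T (sym test≡) (ℚ.≤⇒≤ᵇ (*≤*⇒/≤/ N d (2 * (N * i)) (B * d) (to-cross B≤2i))))
  where
  instance
    _ = m*n≢0 (b * suc N ^ 3) d
  B = b * suc N ^ 3
  low = + (N * i) / d
  width : ∣ + (N * suc i) / d ℚ.- low ∣ ≡ + N / d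
  width = begin
    ∣ + (N * suc i) / d ℚ.- low ∣
      ≡⟨ cong (λ q → ∣ q ℚ.- low ∣) (sym (/+/≡/ N d (N * i) d (N * suc i) d (sum-numerators N i d))) ⟩
    ∣ (+ N / d ℚ.+ low) ℚ.- low ∣       ≡⟨ cong ∣_∣ (//-rightDividesʳ low (+ N / d)) ⟩
    ∣ + N / d ∣                        ≡⟨ ℚ.0≤p⇒∣p∣≡p (*≤*⇒/≤/ 0 1 N d z≤n) ⟩
    + N / d                            ∎
    where
    open ≡-Reasoning
    sum-numerators : ∀ N i d → (N * d + N * i * d) * d ≡ N * suc i * (d * d)
    sum-numerators N i d = solve (N ∷ i ∷ d ∷ [])
  tolerance : epsilon b (suc N) ℚ.* low ≡ + (2 * (N * i)) / (B * d)
  tolerance = /*/≡/ 2 B (N * i) d (2 * (N * i)) (B * d) refl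
  test≡ : stopᵇ (epsilon b (suc N)) ⟨ low , + (N * suc i) / d ⟩ ≡ (+ N / d ℚ.≤ᵇ + (2 * (N * i)) / (B * d))
  test≡ = cong₂ ℚ._≤ᵇ_ width tolerance
  regroup : ∀ N B d i → N * (B * d) ≡ N * d * B × 2 * (N * i) * d ≡ N * d * (2 * i)
  regroup N B d i = solve (N ∷ B ∷ d ∷ []) , solve (N ∷ d ∷ i ∷ [])
  from-cross : N * (B * d) ≤ 2 * (N * i) * d → B ≤ 2 * i
  from-cross h = *-cancelˡ-≤ (N * d) {{m*n≢0 N d}}
    (subst₂ _≤_ (proj₁ (regroup N B d i)) (proj₂ (regroup N B d i)) h)
  to-cross : B ≤ 2 * i → N * (B * d) ≤ 2 * (N * i) * d
  to-cross h = subst₂ _≤_ (sym (proj₁ (regroup N B d i))) (sym (proj₂ (regroup N B d i))) (*-monoʳ-≤ (N * d) h)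

-- Opaque, so that instance search can see that den k is nonzero.
opaque
  den : ℕ → ℕ
  den k = 2 ^ suc k

  den≡2^ : ∀ k → den k ≡ 2 ^ suc k
  den≡2^ k = refl

  den-suc : ∀ k → den (suc k) ≡ 2 * den k
  den-suc k = refl

instance
  den-nonZero : ∀ {k} → NonZero (den k)
  den-nonZero {k} = subst NonZero (sym (den≡2^ k)) (m^n≢0 2 (suc k))

run-suc : ∀ {n} (O : Oracle n) ε s k → run O ε s (suc k) ≡ step O (run O ε s k)
run-suc O ε s zero    = refl
run-suc O ε s (suc k) = run-suc O ε (step O s) k

1≤2*i⇒1≤i : ∀ {i} → 1 ≤ 2 * i → 1 ≤ i
1≤2*i⇒1≤i {suc i} _ = s≤s z≤n

module Bisection {N : ℕ} .{{_ : NonZero N}} (G : Graph (suc N)) (a b : ℕ) .{{_ : NonZero b}} (a≤b : a ≤ b)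
                 (O : Oracle (suc N)) (exact : ExactOracle G (+ a / b) O) where

  open Objective G a b

  n : ℕ
  n = suc N

  ε : ℚ
  ε = epsilon b n

  state : ℕ → State
  state = run O ε (initState n)

  bracket : ℕ → ℕ → State
  bracket k i = ⟨ + (N * i) / den k , + (N * suc i) / den k ⟩

  midpoint : ℕ → ℕ → ℚ
  midpoint k i = + (N * suc (2 * i)) / den (suc k)

  refine : ∀ k j → + (N * j) / den k ≡ + (N * (2 * j)) / den (suc k)
  refine k j = *≡*⇒/≡/ (N * j) (den k) (N * (2 * j)) (den (suc k))
    (trans (cong (N * j *_) (den-suc k)) (regroup N j (den k)))
    where
    regroup : ∀ N j d → N * j * (2 * d) ≡ N * (2 * j) * d
    regroup N j d = solve (N ∷ j ∷ d ∷ [])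

  midpoint≡ : ∀ k i → (lo (bracket k i) ℚ.+ hi (bracket k i)) ℚ.* (+ 1 / 2) ≡ midpoint k i
  midpoint≡ k i = trans
    (cong (ℚ._* (+ 1 / 2)) (/+/≡/ (N * i) (den k) (N * suc i) (den k) (N * suc (2 * i)) (den k) (add-numerators N i (den k))))
    (/*/≡/ (N * suc (2 * i)) (den k) 1 2 (N * suc (2 * i)) (den (suc k))
      (trans (cong (N * suc (2 * i) * 1 *_) (den-suc k)) (halve (N * suc (2 * i)) (den k))))
    where
    add-numerators : ∀ N i d → (N * i * d + N * suc i * d) * d ≡ N * suc (2 * i) * (d * d)
    add-numerators N i d = solve (N ∷ i ∷ d ∷ [])
    halve : ∀ x d → x * 1 * (2 * d) ≡ x * (d * 2)
    halve x d = solve (x ∷ d ∷ [])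

  step-bracket : ∀ k i → step O (bracket k i) ≡
    (if anyV (proj₁ (O (midpoint k i))) then bracket (suc k) (suc (2 * i)) else bracket (suc k) (2 * i))
  step-bracket k i = begin
    step O (bracket k i)
      ≡⟨ cong (λ β → if anyV (proj₁ (O β)) then ⟨ β , hi (bracket k i) ⟩ else ⟨ lo (bracket k i) , β ⟩) (midpoint≡ k i) ⟩
    (if anyV (proj₁ (O (midpoint k i))) then ⟨ midpoint k i , hi (bracket k i) ⟩ else ⟨ lo (bracket k i) , midpoint k i ⟩)
      ≡⟨ cong₂ (if anyV (proj₁ (O (midpoint k i))) then_else_) (cong ⟨ midpoint k i ,_⟩ hi≡) (cong ⟨_, midpoint k i ⟩ (refine k i)) ⟩
    (if anyV (proj₁ (O (midpoint k i))) then bracket (suc k) (suc (2 * i)) else bracket (suc k) (2 * i)) ∎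
    where
    open ≡-Reasoning
    hi≡ : hi (bracket k i) ≡ + (N * suc (suc (2 * i))) / den (suc k)
    hi≡ = trans (refine k (suc i)) (cong (λ j → + (N * j) / den (suc k)) (*-suc 2 i))

  record Invariant (k : ℕ) : Set where
    field
      i      : ℕ
      state≡ : state k ≡ bracket k i
      upper  : ∀ U L → STC G U L → DensityAtMost (U , L) (N * suc i) (den k)
      -- Vacuous while the lower end is the initial 0, which is never queried.
      lower  : 1 ≤ i → Nonempty (proj₁ (O (lo (bracket k i)))) × DensityAtLeast (O (lo (bracket k i))) (N * i) (den k)

  initial : Invariant 0
  initial = record
    { i      = 0
    ; state≡ = cong₂ ⟨_,_⟩ (*≡*⇒/≡/ 0 1 (N * 0) (den 0) (sym (trans (*-identityʳ (N * 0)) (*-zeroʳ N))))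
                           (*≡*⇒/≡/ N 2 (N * 1) (den 0) (trans (cong (N *_) (den≡2^ 0)) (cong (_* 2) (sym (*-identityʳ N)))))
    ; upper  = λ U L _ → subst₂ (DensityAtMost (U , L)) (sym (*-identityʳ N)) (sym (den≡2^ 0)) (density≤[n∸1]/2 a≤b U L)
    ; lower  = λ ()
    }

  refine-invariant : ∀ {k} → Invariant k → Invariant (suc k)
  refine-invariant {k} inv = by-answer _ refl
    where
    open Invariant inv
    answer-at : ℚ → Bool
    answer-at q = anyV (proj₁ (O q))

    moved : ∀ {c} → answer-at (midpoint k i) ≡ c →
            state (suc k) ≡ (if c then bracket (suc k) (suc (2 * i)) else bracket (suc k) (2 * i))
    moved answer = trans (run-suc O ε (initState n) k) (trans (cong (step O) state≡)
      (trans (step-bracket k i) (cong (if_then bracket (suc k) (suc (2 * i)) else bracket (suc k) (2 * i)) answer)))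

    by-answer : ∀ c → answer-at (midpoint k i) ≡ c → Invariant (suc k)
    by-answer true answer = record
      { i      = suc (2 * i)
      ; state≡ = moved answer
      ; upper  = λ U L stc → subst₂ (DensityAtMost (U , L)) (double-suc N i) (sym (den-suc k))
                               (DensityAtMost-double {U , L} {N * suc i} {den k} (upper U L stc))
      ; lower  = λ _ → anyV⇒nonempty _ (subst T (sym answer) _) ,
                       oracle-DensityAtLeast O exact (N * suc (2 * i)) (den (suc k))
      }
      where
      double-suc : ∀ N i → 2 * (N * suc i) ≡ N * suc (suc (2 * i))
      double-suc N i = solve (N ∷ i ∷ [])
    by-answer false answer = record
      { i      = 2 * i
      ; state≡ = moved answer
      ; upper  = oracle-empty⇒DensityAtMost O exact (N * suc (2 * i)) (den (suc k)) answer
      ; lower  = λ 1≤2i → subst (λ q → Nonempty (proj₁ (O q)) × DensityAtLeast (O q) (N * (2 * i)) (den (suc k)))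
                                (refine k i) (kept (lower (1≤2*i⇒1≤i 1≤2i)))
      }
      where
      double : ∀ N i → 2 * (N * i) ≡ N * (2 * i)
      double N i = solve (N ∷ i ∷ [])
      kept : ∀ {s} → Nonempty (proj₁ s) × DensityAtLeast s (N * i) (den k) →
             Nonempty (proj₁ s) × DensityAtLeast s (N * (2 * i)) (den (suc k))
      kept {s} (nonempty , atLeast) =
        nonempty , subst₂ (DensityAtLeast s) (double N i) (sym (den-suc k)) (DensityAtLeast-double {s} {N * i} {den k} atLeast)

  invariant : ∀ k → Invariant k
  invariant zero    = initial
  invariant (suc k) = refine-invariant (invariant k)

  K : ℕ
  K = ⌈log₂ n ⌉ * 5 + ⌈log₂ b ⌉

  0<bn³ : 0 < b * n ^ 3
  0<bn³ = >-nonZero⁻¹ (b * n ^ 3) {{m*n≢0 b (n ^ 3)}}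

  -- The edge {x, y} has density at least 1 / n, which bounds den K by n² (i + 1).
  stops-within-K : ∀ {x y} → toℕ x < toℕ y → T (adj G x y) → T (stopᵇ ε (state K))
  stops-within-K {x} {y} x<y xy =
    subst (T ∘ stopᵇ ε) (sym state≡) (Equivalence.from (stopᵇ-bracket⇔ b (den K) i) (2m≤1+i⇒m≤2i 0<bn³ 2B≤1+i))
    where
    open Invariant (invariant K)
    U₀ = edgeSet x y
    W₀ = scaledWeight U₀ allStrong
    b≤W₀ : b ≤ W₀
    b≤W₀ = ≤-trans (≤-trans (≤-reflexive (sym (*-identityʳ b))) (*-monoʳ-≤ b (edgeSet-strong G x<y xy))) (m≤m+n _ _)
    regroup : ∀ n i b → n * suc i * n * b ≡ b * (n * n * suc i)
    regroup n i b = solve (n ∷ i ∷ b ∷ [])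
    den≤ : den K ≤ n * n * suc i
    den≤ = *-cancelˡ-≤ b (begin
      b * den K                ≤⟨ *-monoˡ-≤ (den K) b≤W₀ ⟩
      W₀ * den K               ≤⟨ upper U₀ allStrong (edgeSet-STC G {x} {y} allStrong) ⟩
      N * suc i * card U₀ * b  ≤⟨ *-monoˡ-≤ b (*-mono-≤ (*-monoˡ-≤ (suc i) (n≤1+n N)) (card≤n U₀)) ⟩
      n * suc i * n * b        ≡⟨ regroup n i b ⟩
      b * (n * n * suc i)      ∎)
      where open ≤-Reasoning
    2B≤1+i : 2 * (b * n ^ 3) ≤ suc i
    2B≤1+i = *-cancelˡ-≤ (n * n) (begin
      n * n * (2 * (b * n ^ 3))  ≡⟨ *-comm (n * n) _ ⟩
      2 * (b * n ^ 3) * (n * n)  ≤⟨ 2bn⁵≤2^[1+5⌈log₂n⌉+⌈log₂b⌉] n b ⟩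
      2 ^ suc K                  ≡⟨ den≡2^ K ⟨
      den K                      ≤⟨ den≤ ⟩
      n * n * suc i              ∎)
      where open ≤-Reasoning

  DensityAtLeast⇒2i≤d : ∀ {s i d} → 0 < card (proj₁ s) → DensityAtLeast s (N * i) d → 2 * i ≤ d
  DensityAtLeast⇒2i≤d {U , L} {i} {d} 0<c atLeast = *-cancelˡ-≤ N
    (subst (_≤ N * d) (trans (*-assoc N i 2) (cong (N *_) (*-comm i 2)))
      (density-bounds-ordered {U} {L} {N * i} {d} {N} {2} 0<c atLeast (density≤[n∸1]/2 a≤b U L)))

  interval<gap : ∀ {c c′ i d} → c ≤ n → c′ ≤ n → b * n ^ 3 ≤ 2 * i → 2 * i ≤ d → N * c * c′ * b < d
  interval<gap {c} {c′} {i} {d} c≤n c′≤n B≤2i 2i≤d = begin-strict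
    N * c * c′ * b   ≤⟨ *-monoˡ-≤ b (*-mono-≤ (*-monoʳ-≤ N c≤n) c′≤n) ⟩
    N * n * n * b    ≡⟨ proj₁ (regroup N n b) ⟩
    N * (n * n * b)  <⟨ *-monoˡ-< (n * n * b) {{m*n≢0 (n * n) b}} (n<1+n N) ⟩
    n * (n * n * b)  ≡⟨ proj₂ (regroup N n b) ⟩
    b * n ^ 3        ≤⟨ B≤2i ⟩
    2 * i            ≤⟨ 2i≤d ⟩
    d                ∎
    where
    open ≤-Reasoning
    regroup : ∀ N n b → N * n * n * b ≡ N * (n * n * b) × n * (n * n * b) ≡ b * (n * (n * (n * 1)))
    regroup N n b = solve (N ∷ n ∷ b ∷ []) , solve (n ∷ b ∷ [])

  optimal-at-stop : ∀ k → T (stopᵇ ε (state k)) → OptimalSTCDen G (+ a / b) (O (lo (state k)))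
  optimal-at-stop k stop = subst (λ s → OptimalSTCDen G (+ a / b) (O (lo s))) (sym state≡) optimal
    where
    open Invariant (invariant k)
    Uₒ = proj₁ (O (lo (bracket k i)))
    Lₒ = proj₂ (O (lo (bracket k i)))
    B≤2i : b * n ^ 3 ≤ 2 * i
    B≤2i = Equivalence.to (stopᵇ-bracket⇔ b (den k) i) (subst (T ∘ stopᵇ ε) state≡ stop)
    found : Nonempty Uₒ × DensityAtLeast (Uₒ , Lₒ) (N * i) (den k)
    found = lower (1≤2*i⇒1≤i (≤-trans 0<bn³ B≤2i))
    0<cₒ : 0 < card Uₒ
    0<cₒ = nonempty⇒0<card Uₒ (proj₁ found)
    optimal : OptimalSTCDen G (+ a / b) (O (lo (bracket k i)))
    optimal = proj₁ found , proj₁ (exact (lo (bracket k i))) , λ U L nonempty stc →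
      *≤*⇒density≤ {U} {L} {Uₒ} {Lₒ} (nonempty⇒0<card U nonempty) 0<cₒ
        (short-interval⇒≤ {N * i} {N} {b} {card Uₒ} {card U} {scaledWeight Uₒ Lₒ} {scaledWeight U L} {den k}
          (subst (λ x → scaledWeight U L * den k ≤ x * card U * b) (trans (*-suc N i) (+-comm N (N * i)))
            (upper U L stc))
          (proj₂ found)
          (interval<gap {i = i} (card≤n Uₒ) (card≤n U) B≤2i (DensityAtLeast⇒2i≤d {Uₒ , Lₒ} {i} 0<cₒ (proj₂ found))))

  stc-ilp-exact : ∀ {x y} → toℕ x < toℕ y → T (adj G x y) →
    ∃[ k ] (k ≤ 5 * (⌈log₂ n ⌉ + ⌈log₂ b ⌉) × StopsAfter O ε k × OptimalSTCDen G (+ a / b) (output O ε k))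
  stc-ilp-exact x<y xy =
    let k , k≤K , stop , before = least-witness (stopᵇ ε ∘ state) K (stops-within-K x<y xy)
    in k , ≤-trans k≤K (m*5+n≤5*[m+n] ⌈log₂ n ⌉ ⌈log₂ b ⌉) , (stop , before) , optimal-at-stop k stop

proposition5p3 :
    ∃[ C ] (∀ (n : ℕ) (G : Graph n) → (∃[ x ] ∃[ y ] T (adj G x y)) →
      (a b : ℕ) → .{{_ : NonZero b}} → a ≤ b →
      (O : Oracle n) → ExactOracle G (+ a / b) O →
      ∃[ k ] (k ≤ C * (⌈log₂ n ⌉ + ⌈log₂ b ⌉)
              × StopsAfter O (epsilon b n) k
              × OptimalSTCDen G (+ a / b) (output O (epsilon b n) k)))
proposition5p3 = 5 , λ where
  zero          G (() , _)
  (suc zero)    G (Fin.zero , Fin.zero , loop) → ⊥-elim (subst T (irrefl G Fin.zero) loop)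
  (suc (suc m)) G edge a b a≤b O exact →
    let x , y , x<y , xy = ordered-edge G edge
    in Bisection.stc-ilp-exact G a b a≤b O exact x<y xy
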